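{- Under the hypotheses listed in the context, for every object (closed type) $A$ of $\mathcal S$ the constant presheaf $\Delta A$ is discrete in $\mathrm{PSh}(\mathbb C)$, i.e. $\forall_{f:\mathbf y\mathbb I\to\Delta A}\forall_{i:\mathbf y\mathbb I}\,fi=f0$ holds in the internal language of $\mathrm{PSh}(\mathbb C)$.
   Context: Hypotheses: $\mathcal S$ is a model of extensional dependent type theory (category with families) with dependent products, dependent sums, extensional identity types, unit type, disjoint finite coproducts and propositional truncation; $\mathrm{Cof}$ is a propositional universe and $\mathcal U$ an impredicative universe in $\mathcal S$ satisfying: for $\varphi,\psi:\mathrm{Cof}$, $\varphi\lor\psi$ has a code in $\mathrm{Cof}$; for $\varphi:\mathrm{Cof}$, $\psi:\varphi\to\mathrm{Cof}$, $\sum_{u:\varphi}\psi u$ has a code in $\mathrm{Cof}$; $\forall_{\varphi,\psi:\mathrm{Cof}}(\varphi\leftrightarrow\psi)\to\varphi=\psi$; and an operation assigning to $\varphi:\mathrm{Cof}$, $A:\varphi\to\mathcal U$, $B:\mathcal U$, $f:\prod_{u:\varphi}Au\cong B$ a pair $(\bar A,\bar f:\bar A\cong B)$ with $\forall_{u:\varphi}(Au,fu)=(\bar A,\bar f)$; $\mathbb C$ is an internal category in $\mathcal S$ with finite products (terminal object $1$) whose hom-equalities belong to $\mathrm{Cof}$; $(\mathbb I,\delta_0,\delta_1,\mu_0,\mu_1)$ is a path connection algebra in $\mathbb C$ (an object with $\delta_0,\delta_1:1\to\mathbb I$, $\mu_0,\mu_1:\mathbb I\times\mathbb I\to\mathbb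 I$ such that $\mu_e(\delta_e\times\mathbb I)=\mu_e(\mathbb I\times\delta_e)=\delta_e$, $\mu_e(\delta_{\bar e}\times\mathbb I)=\mu_e(\mathbb I\times\delta_{\bar e})=\mathrm{id}$); and $\delta_0!_c\neq\delta_1!_c$ for all objects $c$. $\mathrm{PSh}(\mathbb C)$ is the internal presheaf model (contexts: presheaves on $\mathbb C$; types over $\Gamma$: presheaves on the category of elements of $\Gamma$; terms: sections). $\mathbf y$ is the Yoneda embedding and $0,1:\mathbf y\mathbb I$ are induced by $\delta_0,\delta_1$. The constant presheaf $\Delta A$ has $\Delta A(c):=A$ with trivial action. -}

module Defs where

open import Data.Product using (_×_; _,_; proj₁; proj₂)
open import Relation.Binary.PropositionalEquality using (_≡_)
open import Relation.Nullary using (¬_)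

-- The ambient model S is read as Agda's own type theory.

record CatWithProducts : Set₁ where
  infixr 9 _∘_
  field
    Obj : Set
    Hom : Obj → Obj → Set
    id  : ∀ {a} → Hom a a
    _∘_ : ∀ {a b c} → Hom b c → Hom a b → Hom a c
    idˡ : ∀ {a b} (f : Hom a b) → id ∘ f ≡ f
    idʳ : ∀ {a b} (f : Hom a b) → f ∘ id ≡ f
    assoc : ∀ {a b c d} (h : Hom c d) (g : Hom b c) (f : Hom a b) →
            (h ∘ g) ∘ f ≡ h ∘ (g ∘ f)
    𝟙 : Obj
    ! : (a : Obj) → Hom a 𝟙
    !-unique : ∀ {a} (f : Hom a 𝟙) → f ≡ ! a
    _⊗_ : Obj → Obj → Obj
    π₁ : ∀ {a b} → Hom (a ⊗ b) a
    π₂ : ∀ {a b} → Hom (a ⊗ b) b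
    ⟨_,_⟩ : ∀ {c a b} → Hom c a → Hom c b → Hom c (a ⊗ b)
    π₁-β : ∀ {c a b} (f : Hom c a) (g : Hom c b) → π₁ ∘ ⟨ f , g ⟩ ≡ f
    π₂-β : ∀ {c a b} (f : Hom c a) (g : Hom c b) → π₂ ∘ ⟨ f , g ⟩ ≡ g
    ⟨⟩-unique : ∀ {c a b} (h : Hom c (a ⊗ b)) → ⟨ π₁ ∘ h , π₂ ∘ h ⟩ ≡ h

module _ (ℂ : CatWithProducts) where
  open CatWithProducts ℂ

  _×ₕ_ : ∀ {a a' b b'} → Hom a a' → Hom b b' → Hom (a ⊗ b) (a' ⊗ b')
  f ×ₕ g = ⟨ f ∘ π₁ , g ∘ π₂ ⟩

  -- A path connection algebra (𝕀, δ₀, δ₁, μ₀, μ₁) in ℂ: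
  --   μₑ(δₑ × 𝕀) = μₑ(𝕀 × δₑ) = δₑ,   μₑ(δ_ē × 𝕀) = μₑ(𝕀 × δ_ē) = id,
  -- where 𝟙 ⊗ 𝕀 and 𝕀 ⊗ 𝟙 are identified with 𝕀 via the projections
  -- (so "δₑ" on the right means δₑ ∘ !, and "id" means the projection).
  record PathConnectionAlgebra : Set where
    field
      𝕀  : Obj
      δ₀ : Hom 𝟙 𝕀
      δ₁ : Hom 𝟙 𝕀
      μ₀ : Hom (𝕀 ⊗ 𝕀) 𝕀
      μ₁ : Hom (𝕀 ⊗ 𝕀) 𝕀
      μ₀-δ₀-l : μ₀ ∘ (δ₀ ×ₕ id) ≡ δ₀ ∘ ! (𝟙 ⊗ 𝕀)
      μ₀-δ₀-r : μ₀ ∘ (id ×ₕ δ₀) ≡ δ₀ ∘ ! (𝕀 ⊗ 𝟙)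
      μ₁-δ₁-l : μ₁ ∘ (δ₁ ×ₕ id) ≡ δ₁ ∘ ! (𝟙 ⊗ 𝕀)
      μ₁-δ₁-r : μ₁ ∘ (id ×ₕ δ₁) ≡ δ₁ ∘ ! (𝕀 ⊗ 𝟙)
      μ₀-δ₁-l : μ₀ ∘ (δ₁ ×ₕ id) ≡ π₂
      μ₀-δ₁-r : μ₀ ∘ (id ×ₕ δ₁) ≡ π₁
      μ₁-δ₀-l : μ₁ ∘ (δ₀ ×ₕ id) ≡ π₂
      μ₁-δ₀-r : μ₁ ∘ (id ×ₕ δ₀) ≡ π₁

  record Presheaf : Set₁ where
    field
      F₀  : Obj → Set
      act : ∀ {c d} → Hom d c → F₀ c → F₀ d
      act-id : ∀ {c} (x : F₀ c) → act id x ≡ x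
      act-∘  : ∀ {c d e} (g : Hom d c) (h : Hom e d) (x : F₀ c) →
               act (g ∘ h) x ≡ act h (act g x)
  open Presheaf public

  record Nat (F G : Presheaf) : Set where
    field
      η : (c : Obj) → F₀ F c → F₀ G c
      natural : ∀ {c d} (h : Hom d c) (x : F₀ F c) →
                η d (act F h x) ≡ act G h (η c x)
  open Nat public

  𝐲 : Obj → Presheaf
  𝐲 a = record
    { F₀ = λ c → Hom c a
    ; act = λ h f → f ∘ h
    ; act-id = idʳ
    ; act-∘ = λ g h f → assocSym f g h }
    where
    open import Relation.Binary.PropositionalEquality using (sym)
    assocSym : ∀ {c d e} (f : Hom c a) (g : Hom d c) (h : Hom e d) →
               f ∘ (g ∘ h) ≡ (f ∘ g) ∘ h
    assocSym f g h = sym (assoc f g h)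

  _×ᴾ_ : Presheaf → Presheaf → Presheaf
  F ×ᴾ G = record
    { F₀ = λ c → F₀ F c × F₀ G c
    ; act = λ h p → act F h (proj₁ p) , act G h (proj₂ p)
    ; act-id = λ p → cong₂ _,_ (act-id F (proj₁ p)) (act-id G (proj₂ p))
    ; act-∘ = λ g h p → cong₂ _,_ (act-∘ F g h (proj₁ p)) (act-∘ G g h (proj₂ p)) }
    where open import Relation.Binary.PropositionalEquality using (cong₂)

  Δ : Set → Presheaf
  Δ A = record
    { F₀ = λ _ → A
    ; act = λ _ x → x
    ; act-id = λ _ → refl
    ; act-∘ = λ _ _ _ → refl }
    where open import Relation.Binary.PropositionalEquality using (refl)

  Exp₀ : Presheaf → Presheaf → Obj → Set
  Exp₀ F G c = Nat (𝐲 c ×ᴾ F) G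

  -- Application of f ∈ (G^F)(c) at stage d, along g : d → c, to x ∈ F(d)
  -- (i.e. (f · g) x in the internal language).
  appAt : ∀ {F G c d} → Exp₀ F G c → Hom d c → F₀ F d → F₀ G d
  appAt {d = d} f g x = η f d (g , x)

  -- A presheaf X is discrete (w.r.t. the interval 𝐲𝕀) when the internal
  -- formula  ∀ (f : 𝐲𝕀 → X) ∀ (i : 𝐲𝕀). f i = f 0  holds in the empty
  -- context of PSh(ℂ); by Kripke–Joyal forcing this unfolds to: for every
  -- stage c, every f ∈ X^{𝐲𝕀}(c), every d, g : d → c and i ∈ 𝐲𝕀(d),
  -- (f·g) i = (f·g) 0_d, where 0_d = δ₀ ∘ !_d.
  module _ (P : PathConnectionAlgebra) where
    open PathConnectionAlgebra P

    0ᵢ : (d : Obj) → Hom d 𝕀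
    0ᵢ d = δ₀ ∘ ! d

    IsDiscrete : Presheaf → Set
    IsDiscrete X =
      (c : Obj) (f : Exp₀ (𝐲 𝕀) X c) →
      (d : Obj) (g : Hom d c) (i : Hom d 𝕀) →
      appAt {F = 𝐲 𝕀} {G = X} f g i ≡ appAt {F = 𝐲 𝕀} {G = X} f g (0ᵢ d)

{-# OPTIONS --safe #-}
-- The connection μ₀ contracts every point i : d → 𝕀 to 0: the map
-- (x , j) ↦ μ₀ (i x , j) on d × 𝕀 restricts to i at j = 1 and to 0 at j = 0.
-- A natural transformation into a constant presheaf cannot tell apart two
-- restrictions of the same element, so every f : 𝐲𝕀 → ΔA takes the same
-- value at i and at 0.
module Submission where

open import Defs
open import Data.Product using (_,_)
open import Relation.Binary.PropositionalEquality
  using (_≡_; sym; trans; cong; cong₂; module ≡-Reasoning)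
open import Relation.Nullary using (¬_)

module Products (ℂ : CatWithProducts) where
  open CatWithProducts ℂ
  open ≡-Reasoning

  ⟨⟩∘ : ∀ {c d a b} (f : Hom c a) (g : Hom c b) (h : Hom d c) →
        ⟨ f , g ⟩ ∘ h ≡ ⟨ f ∘ h , g ∘ h ⟩
  ⟨⟩∘ f g h = begin
    ⟨ f , g ⟩ ∘ h                                    ≡⟨ sym (⟨⟩-unique _) ⟩
    ⟨ π₁ ∘ (⟨ f , g ⟩ ∘ h) , π₂ ∘ (⟨ f , g ⟩ ∘ h) ⟩  ≡⟨ cong₂ ⟨_,_⟩ (sym (assoc _ _ _)) (sym (assoc _ _ _)) ⟩
    ⟨ (π₁ ∘ ⟨ f , g ⟩) ∘ h , (π₂ ∘ ⟨ f , g ⟩) ∘ h ⟩  ≡⟨ cong₂ ⟨_,_⟩ (cong (_∘ h) (π₁-β f g)) (cong (_∘ h) (π₂-β f g)) ⟩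
    ⟨ f ∘ h , g ∘ h ⟩                                ∎

  ×ₕ∘⟨⟩ : ∀ {c a a' b b'} (f : Hom a a') (g : Hom b b') (x : Hom c a) (y : Hom c b) →
          _×ₕ_ ℂ f g ∘ ⟨ x , y ⟩ ≡ ⟨ f ∘ x , g ∘ y ⟩
  ×ₕ∘⟨⟩ f g x y = begin
    ⟨ f ∘ π₁ , g ∘ π₂ ⟩ ∘ ⟨ x , y ⟩                            ≡⟨ ⟨⟩∘ _ _ _ ⟩
    ⟨ (f ∘ π₁) ∘ ⟨ x , y ⟩ , (g ∘ π₂) ∘ ⟨ x , y ⟩ ⟩            ≡⟨ cong₂ ⟨_,_⟩ (assoc _ _ _) (assoc _ _ _) ⟩
    ⟨ f ∘ (π₁ ∘ ⟨ x , y ⟩) , g ∘ (π₂ ∘ ⟨ x , y ⟩) ⟩            ≡⟨ cong₂ ⟨_,_⟩ (cong (f ∘_) (π₁-β x y)) (cong (g ∘_) (π₂-β x y)) ⟩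
    ⟨ f ∘ x , g ∘ y ⟩                                          ∎

  π₁∘⟨id,-⟩ : ∀ {c d b} (g : Hom d c) (k : Hom d b) → (g ∘ π₁) ∘ ⟨ id , k ⟩ ≡ g
  π₁∘⟨id,-⟩ g k = begin
    (g ∘ π₁) ∘ ⟨ id , k ⟩  ≡⟨ assoc _ _ _ ⟩
    g ∘ (π₁ ∘ ⟨ id , k ⟩)  ≡⟨ cong (g ∘_) (π₁-β _ _) ⟩
    g ∘ id                 ≡⟨ idʳ g ⟩
    g                      ∎

  ⟨-∘π₁,π₂⟩∘⟨id,-⟩ : ∀ {d a b} (i : Hom d a) (k : Hom d b) →
                     ⟨ i ∘ π₁ , π₂ ⟩ ∘ ⟨ id , k ⟩ ≡ ⟨ i , k ⟩
  ⟨-∘π₁,π₂⟩∘⟨id,-⟩ i k = trans (⟨⟩∘ _ _ _) (cong₂ ⟨_,_⟩ (π₁∘⟨id,-⟩ i k) (π₂-β _ _))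

  ∘⟨-,point⟩ : ∀ {d a b x} (m : Hom (a ⊗ b) x) (p : Hom 𝟙 b) (i : Hom d a) →
               m ∘ ⟨ i , p ∘ ! d ⟩ ≡ (m ∘ _×ₕ_ ℂ id p) ∘ ⟨ i , ! d ⟩
  ∘⟨-,point⟩ {d} m p i = begin
    m ∘ ⟨ i , p ∘ ! d ⟩                 ≡⟨ cong (λ z → m ∘ ⟨ z , p ∘ ! d ⟩) (sym (idˡ i)) ⟩
    m ∘ ⟨ id ∘ i , p ∘ ! d ⟩            ≡⟨ cong (m ∘_) (sym (×ₕ∘⟨⟩ id p i (! d))) ⟩
    m ∘ (_×ₕ_ ℂ id p ∘ ⟨ i , ! d ⟩)     ≡⟨ sym (assoc _ _ _) ⟩
    (m ∘ _×ₕ_ ℂ id p) ∘ ⟨ i , ! d ⟩     ∎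

module Connection (ℂ : CatWithProducts) (P : PathConnectionAlgebra ℂ) where
  open CatWithProducts ℂ
  open PathConnectionAlgebra P
  open Products ℂ
  open ≡-Reasoning

  μ₀-unitʳ : ∀ {d} (i : Hom d 𝕀) → μ₀ ∘ ⟨ i , δ₁ ∘ ! d ⟩ ≡ i
  μ₀-unitʳ {d} i = begin
    μ₀ ∘ ⟨ i , δ₁ ∘ ! d ⟩               ≡⟨ ∘⟨-,point⟩ μ₀ δ₁ i ⟩
    (μ₀ ∘ _×ₕ_ ℂ id δ₁) ∘ ⟨ i , ! d ⟩   ≡⟨ cong (_∘ ⟨ i , ! d ⟩) μ₀-δ₁-r ⟩
    π₁ ∘ ⟨ i , ! d ⟩                    ≡⟨ π₁-β _ _ ⟩
    i                                   ∎

  μ₀-zeroʳ : ∀ {d} (i : Hom d 𝕀) → μ₀ ∘ ⟨ i , δ₀ ∘ ! d ⟩ ≡ δ₀ ∘ ! d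
  μ₀-zeroʳ {d} i = begin
    μ₀ ∘ ⟨ i , δ₀ ∘ ! d ⟩               ≡⟨ ∘⟨-,point⟩ μ₀ δ₀ i ⟩
    (μ₀ ∘ _×ₕ_ ℂ id δ₀) ∘ ⟨ i , ! d ⟩   ≡⟨ cong (_∘ ⟨ i , ! d ⟩) μ₀-δ₀-r ⟩
    (δ₀ ∘ ! (𝕀 ⊗ 𝟙)) ∘ ⟨ i , ! d ⟩      ≡⟨ assoc _ _ _ ⟩
    δ₀ ∘ (! (𝕀 ⊗ 𝟙) ∘ ⟨ i , ! d ⟩)      ≡⟨ cong (δ₀ ∘_) (!-unique _) ⟩
    δ₀ ∘ ! d                            ∎

  contraction : ∀ {d} → Hom d 𝕀 → Hom (d ⊗ 𝕀) 𝕀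
  contraction i = μ₀ ∘ ⟨ i ∘ π₁ , π₂ ⟩

  contraction∘⟨id,-⟩ : ∀ {d} (i k : Hom d 𝕀) → contraction i ∘ ⟨ id , k ⟩ ≡ μ₀ ∘ ⟨ i , k ⟩
  contraction∘⟨id,-⟩ i k = trans (assoc _ _ _) (cong (μ₀ ∘_) (⟨-∘π₁,π₂⟩∘⟨id,-⟩ i k))

  contraction-at-δ₁ : ∀ {d} (i : Hom d 𝕀) → contraction i ∘ ⟨ id , δ₁ ∘ ! d ⟩ ≡ i
  contraction-at-δ₁ {d} i = trans (contraction∘⟨id,-⟩ i (δ₁ ∘ ! d)) (μ₀-unitʳ i)

  contraction-at-δ₀ : ∀ {d} (i : Hom d 𝕀) → contraction i ∘ ⟨ id , δ₀ ∘ ! d ⟩ ≡ δ₀ ∘ ! d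
  contraction-at-δ₀ {d} i = trans (contraction∘⟨id,-⟩ i (δ₀ ∘ ! d)) (μ₀-zeroʳ i)

module ConstantPresheaf (ℂ : CatWithProducts) where
  open CatWithProducts ℂ

  Nat-Δ-restriction-invariant :
    ∀ {F A d e} (f : Nat ℂ F (Δ ℂ A)) (s s' : Hom d e) (y : F₀ F e) →
    η f d (act F s y) ≡ η f d (act F s' y)
  Nat-Δ-restriction-invariant f s s' y = trans (natural f s y) (sym (natural f s' y))

  module _ (P : PathConnectionAlgebra ℂ) where
    open PathConnectionAlgebra P
    open Products ℂ
    open ≡-Reasoning

    Nat-Δ-homotopy-invariant :
      ∀ {A c d} (f : Nat ℂ (_×ᴾ_ ℂ (𝐲 ℂ c) (𝐲 ℂ 𝕀)) (Δ ℂ A)) (g : Hom d c) (i j : Hom d 𝕀)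
      (h : Hom (d ⊗ 𝕀) 𝕀) → h ∘ ⟨ id , δ₁ ∘ ! d ⟩ ≡ i → h ∘ ⟨ id , δ₀ ∘ ! d ⟩ ≡ j →
      η f d (g , i) ≡ η f d (g , j)
    Nat-Δ-homotopy-invariant {c = c} {d} f g i j h h₁ h₀ = begin
      η f d (g , i)                                 ≡⟨ cong (η f d) (cong₂ _,_ (sym (π₁∘⟨id,-⟩ g _)) (sym h₁)) ⟩
      η f d (act F ⟨ id , δ₁ ∘ ! d ⟩ (g ∘ π₁ , h))  ≡⟨ Nat-Δ-restriction-invariant f _ _ _ ⟩
      η f d (act F ⟨ id , δ₀ ∘ ! d ⟩ (g ∘ π₁ , h))  ≡⟨ cong (η f d) (cong₂ _,_ (π₁∘⟨id,-⟩ g _) h₀) ⟩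
      η f d (g , j)                                 ∎
      where
      F : Presheaf ℂ
      F = _×ᴾ_ ℂ (𝐲 ℂ c) (𝐲 ℂ 𝕀)

proposition4p7 : (ℂ : CatWithProducts) (P : PathConnectionAlgebra ℂ) →
    ((c : CatWithProducts.Obj ℂ) →
      ¬ (CatWithProducts._∘_ ℂ (PathConnectionAlgebra.δ₀ P) (CatWithProducts.! ℂ c)
         ≡ CatWithProducts._∘_ ℂ (PathConnectionAlgebra.δ₁ P) (CatWithProducts.! ℂ c))) →
    (A : Set) → IsDiscrete ℂ P (Δ ℂ A)
proposition4p7 ℂ P _ A c f d g i =
  Nat-Δ-homotopy-invariant P f g i (0ᵢ ℂ P d) (contraction i)
    (contraction-at-δ₁ i) (contraction-at-δ₀ i)
  where
  open ConstantPresheaf ℂ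
  open Connection ℂ P
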